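{- Let $f,g\colon\mathbb{Z}\to\mathbb{N}$ be almost periodic functions taking only finite values. Then $f\mathrel{E_{\mathrm{fin}}}g$ if and only if $f$ and $g$ have the same finite successive segments, i.e. for every $n\in\mathbb{Z}$ and $i\ge 0$ there is $n'$ with $(f(n),\dots,f(n+i))=(g(n'),\dots,g(n'+i))$, and vice versa.
   Context: A function $f\colon\mathbb{Z}\to\mathbb{N}\cup\{\infty\}$ is almost periodic if it is not periodic but for every $n\in\mathbb{N}$ the function $f^{\le n}:=\min(n,f)$ is periodic. For $f,g\colon\mathbb{Z}\to\mathbb{N}\cup\{\infty\}$, $f\mathrel{E_{\mathbb{Z}}}g$ means there is $n\in\mathbb{Z}$ with $f(m)=g(m+n)$ for all $m$, and $f\mathrel{E_{\mathrm{fin}}}g$ means $f^{\le \ell}\mathrel{E_{\mathbb{Z}}}g^{\le\ell}$ for every $\ell\in\mathbb{N}$. -}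

module Defs where

open import Data.Nat using (ℕ; suc; _⊓_; _≤_)
open import Data.Integer using (ℤ; +_; _+_)
open import Data.Product using (Σ; ∃; _×_)
open import Relation.Binary.PropositionalEquality using (_≡_)
open import Relation.Nullary using (¬_)

-- Functions ℤ → ℕ (finite-valued functions ℤ → ℕ ∪ {∞}).

trunc : ℕ → (ℤ → ℕ) → (ℤ → ℕ)
trunc n f m = n ⊓ f m

Periodic : (ℤ → ℕ) → Set
Periodic f = ∃ λ (p : ℕ) → ∀ (m : ℤ) → f (m + + suc p) ≡ f m

AlmostPeriodic : (ℤ → ℕ) → Set
AlmostPeriodic f = ¬ Periodic f × (∀ (n : ℕ) → Periodic (trunc n f))

EZ : (ℤ → ℕ) → (ℤ → ℕ) → Set
EZ f g = ∃ λ (n : ℤ) → ∀ (m : ℤ) → f m ≡ g (m + n)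

Efin : (ℤ → ℕ) → (ℤ → ℕ) → Set
Efin f g = ∀ (ℓ : ℕ) → EZ (trunc ℓ f) (trunc ℓ g)

SegmentsIn : (ℤ → ℕ) → (ℤ → ℕ) → Set
SegmentsIn f g = ∀ (n : ℤ) (i : ℕ) → ∃ λ (n′ : ℤ) →
  ∀ (k : ℕ) → k ≤ i → f (n + + k) ≡ g (n′ + + k)

SameSegments : (ℤ → ℕ) → (ℤ → ℕ) → Set
SameSegments f g = SegmentsIn f g × SegmentsIn g f

{-# OPTIONS --safe #-}
module Submission where

-- If f^{≤ℓ} and g^{≤ℓ} agree up to a shift s, and ℓ exceeds every value of f on
-- a window, then f and g agree exactly on that window (shifted by s): the truncation at ℓ
-- loses nothing there.  Conversely, f^{≤ℓ} and g^{≤ℓ} have a common period N, so each is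
-- determined by its values on [0, N); a segment of g matching f on [0, N] then shifts one
-- truncation onto the other.

open import Defs
open import Data.Nat.Base as ℕ using (ℕ; zero; suc; z≤n; _⊓_; _⊔_; _≤_; _<_; NonZero)
import Data.Nat.Properties as ℕ
open import Data.Integer.Base as ℤ using (ℤ; +_; -[1+_]; _+_; _*_; -_; 0ℤ; 1ℤ)
import Data.Integer.Properties as ℤ
open import Data.Integer.DivMod using (_%ℕ_; _/ℕ_; a≡a%ℕn+[a/ℕn]*n; n%ℕd<d)
open import Data.Integer.Tactic.RingSolver using (solve-∀)
open import Data.Product using (∃; _×_; _,_; proj₁; proj₂)
open import Data.Sum using (inj₁; inj₂; [_,_]′)
open import Function.Bundles using (_⇔_; mk⇔)
open import Level using (Level)
open import Relation.Binary.PropositionalEquality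
open import Relation.Nullary using (contradiction)
open ≡-Reasoning

private
  variable
    a : Level
    A : Set a
    f g : ℤ → ℕ

bounded-on-window : (h : ℕ → ℕ) (i : ℕ) → ∃ λ b → ∀ k → k ≤ i → h k < b
bounded-on-window h zero = suc (h zero) , λ { zero z≤n → ℕ.n<1+n (h zero) }
bounded-on-window h (suc i) with bounded-on-window h i
... | b , h<b = b ⊔ suc (h (suc i)) , bound
  where
  bound : ∀ k → k ≤ suc i → h k < b ⊔ suc (h (suc i))
  bound k k≤1+i with ℕ.m≤n⇒m<n∨m≡n k≤1+i
  ... | inj₁ k<1+i = ℕ.<-≤-trans (h<b k (ℕ.<⇒≤pred k<1+i)) (ℕ.m≤m⊔n b _)
  ... | inj₂ refl  = ℕ.<-≤-trans (ℕ.n<1+n (h k)) (ℕ.m≤n⊔m b _)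

m⊓n≡m⊓o⇒n<m⇒n≡o : ∀ {m n o} → m ⊓ n ≡ m ⊓ o → n < m → n ≡ o
m⊓n≡m⊓o⇒n<m⇒n≡o {m} {n} {o} m⊓n≡m⊓o n<m =
  [ (λ m⊓o≡m → contradiction (trans n≡m⊓o m⊓o≡m) (ℕ.<⇒≢ n<m)) , trans n≡m⊓o ]′ (ℕ.⊓-sel m o)
  where
  n≡m⊓o : n ≡ m ⊓ o
  n≡m⊓o = trans (sym (ℕ.m≥n⇒m⊓n≡n (ℕ.<⇒≤ n<m))) m⊓n≡m⊓o

HasPeriod : (ℤ → A) → ℤ → Set _
HasPeriod h d = ∀ m → h (m + d) ≡ h m

module _ {h : ℤ → A} {d : ℤ} (period : HasPeriod h d) where

  HasPeriod-ℕ* : ∀ k → HasPeriod h (+ k * d)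
  HasPeriod-ℕ* zero    m = cong h (ℤ.+-identityʳ m)
  HasPeriod-ℕ* (suc k) m = begin
    h (m + (1ℤ + + k) * d) ≡⟨ cong h (regroup m (+ k) d) ⟩
    h ((m + + k * d) + d)  ≡⟨ period (m + + k * d) ⟩
    h (m + + k * d)        ≡⟨ HasPeriod-ℕ* k m ⟩
    h m                    ∎
    where
    regroup : ∀ m x d → m + (1ℤ + x) * d ≡ (m + x * d) + d
    regroup = solve-∀

  HasPeriod-* : ∀ i → HasPeriod h (i * d)
  HasPeriod-* (+ k)     = HasPeriod-ℕ* k
  HasPeriod-* -[1+ k ] m = begin
    h (m + - x * d)           ≡⟨ HasPeriod-ℕ* (suc k) (m + - x * d) ⟨
    h ((m + - x * d) + x * d) ≡⟨ cong h (cancel m x d) ⟩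
    h m                       ∎
    where
    x = + suc k
    cancel : ∀ m x d → (m + - x * d) + x * d ≡ m
    cancel = solve-∀

shifted-on-window⇒shifted : ∀ {h k : ℤ → A} (n : ℕ) .{{_ : NonZero n}} {s : ℤ} →
  HasPeriod h (+ n) → HasPeriod k (+ n) →
  (∀ r → r < n → h (+ r) ≡ k (s + + r)) → ∀ m → h m ≡ k (m + s)
shifted-on-window⇒shifted {h = h} {k} n {s} periodʰ periodᵏ window m = begin
  h m                     ≡⟨ cong h m≡r+qn ⟩
  h (+ r + q * + n)       ≡⟨ HasPeriod-* periodʰ q (+ r) ⟩
  h (+ r)                 ≡⟨ window r (n%ℕd<d m n) ⟩
  k (s + + r)             ≡⟨ HasPeriod-* periodᵏ q (s + + r) ⟨
  k ((s + + r) + q * + n) ≡⟨ cong k (regroup s (+ r) q (+ n)) ⟩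
  k ((+ r + q * + n) + s) ≡⟨ cong (λ x → k (x + s)) m≡r+qn ⟨
  k (m + s)               ∎
  where
  r = m %ℕ n
  q = m /ℕ n
  m≡r+qn : m ≡ + r + q * + n
  m≡r+qn = a≡a%ℕn+[a/ℕn]*n m n
  regroup : ∀ s r q n → (s + r) + q * n ≡ (r + q * n) + s
  regroup = solve-∀

common-period : ∀ {h k : ℤ → A} {p q : ℕ} →
  HasPeriod h (+ suc p) → HasPeriod k (+ suc q) →
  HasPeriod h (+ (suc p ℕ.* suc q)) × HasPeriod k (+ (suc p ℕ.* suc q))
common-period {h = h} {p = p} {q} periodʰ periodᵏ =
  subst (HasPeriod h) (cong +_ (ℕ.*-comm (suc q) (suc p))) (HasPeriod-* periodʰ (+ suc q)) ,
  HasPeriod-* periodᵏ (+ suc p)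

EZ-sym : EZ f g → EZ g f
EZ-sym {f} {g} (s , f≡g∘+s) = - s , λ m → sym (begin
  f (m + - s)       ≡⟨ f≡g∘+s (m + - s) ⟩
  g ((m + - s) + s) ≡⟨ cong g (cancel m s) ⟩
  g m               ∎)
  where
  cancel : ∀ m s → (m + - s) + s ≡ m
  cancel = solve-∀

Efin-sym : Efin f g → Efin g f
Efin-sym e ℓ = EZ-sym (e ℓ)

Efin⇒SegmentsIn : Efin f g → SegmentsIn f g
Efin⇒SegmentsIn {f} {g} e n i with bounded-on-window (λ k → f (n + + k)) i
... | b , f<b with e b
... | s , trunc-f≡trunc-g = n + s , λ k k≤i → begin
  f (n + + k)       ≡⟨ m⊓n≡m⊓o⇒n<m⇒n≡o (trunc-f≡trunc-g (n + + k)) (f<b k k≤i) ⟩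
  g ((n + + k) + s) ≡⟨ cong g (ℤ.+-assoc n (+ k) s) ⟩
  g (n + (+ k + s)) ≡⟨ cong (λ x → g (n + x)) (ℤ.+-comm (+ k) s) ⟩
  g (n + (s + + k)) ≡⟨ cong g (ℤ.+-assoc n s (+ k)) ⟨
  g ((n + s) + + k) ∎

SegmentsIn⇒Efin : (∀ ℓ → Periodic (trunc ℓ f)) → (∀ ℓ → Periodic (trunc ℓ g)) →
  SegmentsIn f g → Efin f g
SegmentsIn⇒Efin {f} {g} periodicᶠ periodicᵍ segments ℓ
  with periodicᶠ ℓ | periodicᵍ ℓ
... | p , periodᶠ | q , periodᵍ =
  s , shifted-on-window⇒shifted n (proj₁ periods) (proj₂ periods) window
  where
  n = suc p ℕ.* suc q
  periods = common-period periodᶠ periodᵍ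
  s = proj₁ (segments 0ℤ n)
  window : ∀ r → r < n → trunc ℓ f (+ r) ≡ trunc ℓ g (s + + r)
  window r r<n = cong (ℓ ⊓_) (proj₂ (segments 0ℤ n) r (ℕ.<⇒≤ r<n))

proposition5p4 : (f g : ℤ → ℕ) → AlmostPeriodic f → AlmostPeriodic g →
    (Efin f g ⇔ SameSegments f g)
proposition5p4 f g (_ , periodicᶠ) (_ , periodicᵍ) = mk⇔
  (λ e → Efin⇒SegmentsIn {f} {g} e , Efin⇒SegmentsIn {g} {f} (Efin-sym {f} {g} e))
  (λ (f-in-g , _) → SegmentsIn⇒Efin periodicᶠ periodicᵍ f-in-g)
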